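{- Let $T$ be a finite tree and $P=p_0p_1\dots p_k$ a path in $T$ whose interior vertices $p_1,\dots,p_{k-1}$ all have degree two in $T$. Let $T'$ be obtained from $T$ by deleting all edges between $p_k$ and $\Gamma(p_k)\setminus\{p_{k-1}\}$ and adding all edges between $p_0$ and $\Gamma(p_k)\setminus\{p_{k-1}\}$. Let $B$ be the vertex set of the component of $p_k$ in $T-E(P)$. If $k$ is odd, then for every integer $\ell\ge1$, \[\omega_{\ell}(p_0,T[B\cup P])-\omega_{\ell}(p_0,P)\leq \omega_{\ell}(p_0,T'[B\cup P])-\omega_{\ell}(p_0,P).\]
   Context: $\Gamma(v)$ is the set of neighbours of $v$ in $T$. For a graph $G$ and a vertex $x$, $\omega_\ell(x,G)$ is the number of walks of length $\ell$ in $G$ starting at $x$. $T[X]$, $T'[X]$ denote induced subgraphs on vertex set $X$; $P$ is regarded both as a path and as its vertex set. -}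

module Defs where

open import Data.Bool using (Bool; true; false; _∧_; _∨_; not; if_then_else_)
open import Data.Nat using (ℕ; zero; suc; _+_; _*_; _∸_; _≤_; _<_)
open import Data.Fin using (Fin; _≟_)
open import Data.List using (List; []; _∷_; _++_; [_]; length; map; allFin; upTo)
open import Data.Nat.ListAction using (sum)
open import Data.Bool.ListAction using (any)
open import Data.List.Relation.Unary.Unique.Propositional using (Unique)
open import Data.Product using (Σ; ∃; _×_; _,_)
open import Relation.Nullary using (¬_)
open import Relation.Nullary.Decidable using (⌊_⌋)
open import Relation.Binary.PropositionalEquality using (_≡_)

Adj : ℕ → Set
Adj n = Fin n → Fin n → Bool

_==_ : ∀ {n} → Fin n → Fin n → Bool
x == y = ⌊ x ≟ y ⌋

record SimpleGraph (n : ℕ) : Set where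
  field
    adj    : Adj n
    sym    : ∀ x y → adj x y ≡ adj y x
    irrefl : ∀ x → adj x x ≡ false
open SimpleGraph public

data Walk {n : ℕ} (a : Adj n) : Fin n → Fin n → Set where
  here : ∀ x → Walk a x x
  step : ∀ {x y z} → a x y ≡ true → Walk a y z → Walk a x z

Connected : ∀ {n} → Adj n → Set
Connected a = ∀ u v → Walk a u v

data Chain {n : ℕ} (a : Adj n) : List (Fin n) → Set where
  nil  : Chain a []
  one  : ∀ x → Chain a (x ∷ [])
  cons : ∀ {x y ys} → a x y ≡ true → Chain a (y ∷ ys) → Chain a (x ∷ y ∷ ys)

HasCycle : ∀ {n} → Adj n → Set
HasCycle a = Σ _ λ x → Σ _ λ ys →
  (2 ≤ length ys) × Unique (x ∷ ys) × Chain a (x ∷ ys ++ [ x ])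

IsTree : ∀ {n} → SimpleGraph n → Set
IsTree G = Connected (adj G) × ¬ HasCycle (adj G)

deg : ∀ {n} → Adj n → Fin n → ℕ
deg {n} a x = sum (map (λ y → if a x y then 1 else 0) (allFin n))

-- p = p₀ p₁ … p_k is a path in the graph (given by p : ℕ → Fin n, only i ≤ k matter)
IsPathIn : ∀ {n} → Adj n → (k : ℕ) → (ℕ → Fin n) → Set
IsPathIn a k p = (∀ i j → i ≤ k → j ≤ k → p i ≡ p j → i ≡ j)
               × (∀ i → i < k → a (p i) (p (suc i)) ≡ true)

InteriorDegTwo : ∀ {n} → Adj n → (k : ℕ) → (ℕ → Fin n) → Set
InteriorDegTwo a k p = ∀ i → 1 ≤ i → i < k → deg a (p i) ≡ 2

pathAdj : ∀ {n} → (k : ℕ) → (ℕ → Fin n) → Adj n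
pathAdj k p x y = any (λ i → (x == p i ∧ y == p (suc i)) ∨ (y == p i ∧ x == p (suc i))) (upTo k)

inPath : ∀ {n} → (k : ℕ) → (ℕ → Fin n) → Fin n → Bool
inPath k p x = any (λ i → x == p i) (upTo (suc k))

minusPathEdges : ∀ {n} → Adj n → (k : ℕ) → (ℕ → Fin n) → Adj n
minusPathEdges a k p x y = a x y ∧ not (pathAdj k p x y)

moveAdj : ∀ {n} → Adj n → (k : ℕ) → (ℕ → Fin n) → Adj n
moveAdj a k p x y =
  (a x y ∧ not ((x == p k ∧ N y) ∨ (y == p k ∧ N x)))
  ∨ (x == p 0 ∧ N y) ∨ (y == p 0 ∧ N x)
  where
  N : _ → Bool
  N z = a (p k) z ∧ not (z == p (k ∸ 1))

induced : ∀ {n} → (Fin n → Bool) → Adj n → Adj n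
induced S a x y = S x ∧ S y ∧ a x y

ω : ∀ {n} → ℕ → Fin n → Adj n → ℕ
ω zero    x a = 1
ω {n} (suc ℓ) x a = sum (map (λ y → if a x y then ω ℓ y a else 0) (allFin n))

Odd : ℕ → Set
Odd k = ∃ λ m → k ≡ suc (2 * m)

module Submission where

-- Put S = B ∪ P, G = T[S], G' = T'[S] and N = Γ(pₖ) ∖ {pₖ₋₁}.  The term ω_ℓ(p₀,P)
-- cancels, so the claim is ω_ℓ(p₀,G) ≤ ω_ℓ(p₀,G').  If N = ∅ then T' = T.  Otherwise
-- pick z ∈ N and argue in two steps.
--  * Reflection.  In G the walk p₀ p₁ … pₖ z has even length k+1, its end p₀ is a
--    leaf and its first half consists of degree-two vertices; comparing mirror
--    vertices step by step gives ω_{t+1}(p₀,G) ≤ ω_t(pₖ,G) ≤ ω_{t+1}(pₖ,G).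
--  * Comparison.  By simultaneous induction on t: ω_t(p_i,G) ≤ ω_t(p_j,G') whenever
--    i + j = k, and ω_t(v,G) ≤ ω_t(v,G') for v ∈ B ∖ {pₖ}.  Taking i = k, j = 0 ends it.

open import Defs hiding (sym)
open import Algebra.Properties.CommutativeSemigroup using (interchange)
open import Data.Bool using (Bool; true; false; _∧_; _∨_; not; if_then_else_)
open import Data.Bool.ListAction using (any; or)
open import Data.Bool.Properties
  using (∧-conicalˡ; ∧-conicalʳ; ∧-zeroʳ; ∨-zeroʳ; ∨-comm; ¬-not; T-≡) renaming (_≟_ to _≟ᵇ_)
open import Data.Empty using (⊥; ⊥-elim)
open import Data.Fin using (Fin; _≟_) renaming (zero to fzero; suc to fsuc)
import Data.Fin.Properties as Fin
open import Data.Integer using (+_; _-_) renaming (_≤_ to _≤ℤ_)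
import Data.Integer as ℤ
import Data.Integer.Properties as ℤ
open import Data.List using (List; []; _∷_; _++_; [_]; map; allFin; length; applyUpTo; upTo)
open import Data.List.Membership.Propositional using (_∈_; find; lose)
open import Data.List.Membership.Propositional.Properties
  using (∈-upTo⁺; ∈-upTo⁻; ∈-applyUpTo⁻; ∈-++⁺ˡ)
open import Data.List.Properties using (map-cong; map-tabulate; ++-assoc; length-++; length-applyUpTo)
open import Data.List.Relation.Unary.All as All using (All; []; _∷_)
open import Data.List.Relation.Unary.All.Properties using (¬Any⇒All¬; ++⁻ˡ; ++⁻ʳ)
open import Data.List.Relation.Unary.Any using (here; there) renaming (any? to Any-any?)
open import Data.List.Relation.Unary.Any.Properties using (any⁺; any⁻)
open import Data.List.Relation.Unary.AllPairs using ([]; _∷_)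
open import Data.List.Relation.Unary.Unique.Propositional using (Unique)
open import Data.List.Relation.Unary.Unique.Propositional.Properties using (++⁺; applyUpTo⁺₁)
open import Data.Nat using (ℕ; zero; suc; _+_; _*_; _≤_; _<_; _≤?_; z≤n; s≤s; s≤s⁻¹)
  renaming (_≟_ to _≟ℕ_)
open import Data.Nat.ListAction using (sum)
open import Data.Nat.Properties
  using ( ≤-refl; ≤-reflexive; ≤-trans; <⇒≤; <⇒≢; ≤∧≢⇒<; <-irrefl; <-≤-trans; n<1+n; n≤1+n
        ; m≤m+n; m≤n+m; m<m+n; +-mono-≤; +-monoʳ-≤; +-comm; +-suc; +-identityʳ; *-suc; 1+n≢n; 1+n≢0
        ; n≢0⇒n>0; even≢odd; suc-injective; +-commutativeSemigroup; module ≤-Reasoning)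
open import Data.Product using (Σ; _×_; _,_; proj₁; proj₂)
open import Data.Sum using (_⊎_; inj₁; inj₂)
open import Function using (_∘_; id)
open import Function.Bundles using (Equivalence)
open import Relation.Nullary using (¬_; Dec; yes; no)
open import Relation.Binary.PropositionalEquality
  using (_≡_; _≢_; refl; sym; trans; cong; cong₂; subst; module ≡-Reasoning)

bool-dec : (b : Bool) → b ≡ true ⊎ b ≡ false
bool-dec true = inj₁ refl
bool-dec false = inj₂ refl

contradictory : ∀ {b} → b ≡ true → b ≡ false → ⊥
contradictory refl ()

∧-intro : ∀ {b c} → b ≡ true → c ≡ true → b ∧ c ≡ true
∧-intro refl refl = refl

∨-split : ∀ {b c} → b ∨ c ≡ true → b ≡ true ⊎ c ≡ true
∨-split {true} _ = inj₁ refl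
∨-split {false} c≡true = inj₂ c≡true

==-refl : ∀ {n} (x : Fin n) → (x == x) ≡ true
==-refl x with x ≟ x
... | yes _ = refl
... | no x≢x = ⊥-elim (x≢x refl)

==-sound : ∀ {n} {x y : Fin n} → (x == y) ≡ true → x ≡ y
==-sound {x = x} {y} x==y with x ≟ y
... | yes x≡y = x≡y
==-sound () | no _

==-distinct : ∀ {n} {x y : Fin n} → x ≢ y → (x == y) ≡ false
==-distinct {x = x} {y} x≢y with x ≟ y
... | yes x≡y = ⊥-elim (x≢y x≡y)
... | no _ = refl

any-upTo⁻ : ∀ (g : ℕ → Bool) {k} → any g (upTo k) ≡ true → Σ ℕ λ i → i < k × g i ≡ true
any-upTo⁻ g {k} e with find (any⁻ g (upTo k) (Equivalence.from T-≡ e))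
... | i , i∈upTo , gi = i , ∈-upTo⁻ i∈upTo , Equivalence.to T-≡ gi

any-upTo⁺ : ∀ (g : ℕ → Bool) {k i} → i < k → g i ≡ true → any g (upTo k) ≡ true
any-upTo⁺ g i<k gi = Equivalence.to T-≡ (any⁺ g (lose (∈-upTo⁺ i<k) (Equivalence.from T-≡ gi)))

-- The adjacency of the moved graph T' has the Boolean shape (e ∧ ¬(r₁ ∨ r₂)) ∨ s₁ ∨ s₂:
-- an old edge e survives unless removed (r), and new edges s are added.
moved-kept : ∀ {e r₁ r₂} s₁ s₂ → e ≡ true → r₁ ≡ false → r₂ ≡ false →
  (e ∧ not (r₁ ∨ r₂)) ∨ s₁ ∨ s₂ ≡ true
moved-kept _ _ refl refl refl = refl

moved-added₁ : ∀ {s₁} e r₁ r₂ s₂ → s₁ ≡ true → (e ∧ not (r₁ ∨ r₂)) ∨ s₁ ∨ s₂ ≡ true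
moved-added₁ e r₁ r₂ s₂ refl = ∨-zeroʳ (e ∧ not (r₁ ∨ r₂))

moved-added₂ : ∀ {s₂} e r₁ r₂ s₁ → s₂ ≡ true → (e ∧ not (r₁ ∨ r₂)) ∨ s₁ ∨ s₂ ≡ true
moved-added₂ e r₁ r₂ s₁ refl rewrite ∨-zeroʳ s₁ = ∨-zeroʳ (e ∧ not (r₁ ∨ r₂))

moved-unchanged : ∀ e {r₁ r₂ s₁ s₂} → r₁ ≡ false → r₂ ≡ false → s₁ ≡ false → s₂ ≡ false →
  (e ∧ not (r₁ ∨ r₂)) ∨ s₁ ∨ s₂ ≡ e
moved-unchanged true refl refl refl refl = refl
moved-unchanged false refl refl refl refl = refl

-- Finite sums over the vertex set Fin n

Σf : ∀ {n} → (Fin n → ℕ) → ℕ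
Σf {n} f = sum (map f (allFin n))

sum-mono : ∀ {A : Set} (xs : List A) {f g : A → ℕ} → (∀ x → f x ≤ g x) → sum (map f xs) ≤ sum (map g xs)
sum-mono [] _ = z≤n
sum-mono (x ∷ xs) f≤g = +-mono-≤ (f≤g x) (sum-mono xs f≤g)

sum-+ : ∀ {A : Set} (xs : List A) (f g : A → ℕ) →
  sum (map (λ x → f x + g x) xs) ≡ sum (map f xs) + sum (map g xs)
sum-+ [] f g = refl
sum-+ (x ∷ xs) f g =
  trans (cong (_+_ (f x + g x)) (sum-+ xs f g)) (interchange +-commutativeSemigroup (f x) (g x) _ _)

sum-zero : ∀ {A : Set} (xs : List A) (f : A → ℕ) → (∀ x → f x ≡ 0) → sum (map f xs) ≡ 0
sum-zero [] f f≡0 = refl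
sum-zero (x ∷ xs) f f≡0 rewrite f≡0 x = sum-zero xs f f≡0

Σ-cong : ∀ {n} {f g : Fin n → ℕ} → (∀ x → f x ≡ g x) → Σf f ≡ Σf g
Σ-cong {n} f≡g = cong sum (map-cong f≡g (allFin n))

Σ-mono : ∀ {n} {f g : Fin n → ℕ} → (∀ x → f x ≤ g x) → Σf f ≤ Σf g
Σ-mono {n} = sum-mono (allFin n)

Σ-+ : ∀ {n} (f g : Fin n → ℕ) → Σf (λ x → f x + g x) ≡ Σf f + Σf g
Σ-+ {n} = sum-+ (allFin n)

Σ-suc : ∀ {n} (f : Fin (suc n) → ℕ) → Σf f ≡ f fzero + Σf (f ∘ fsuc)
Σ-suc {n} f = cong (_+_ (f fzero)) (cong sum (trans (map-tabulate fsuc f) (sym (map-tabulate id (f ∘ fsuc)))))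

Σ-remove : ∀ {n} (f : Fin n → ℕ) (c : Fin n) → Σf f ≡ f c + Σf (λ y → if y == c then 0 else f y)
Σ-remove {suc n} f fzero = trans (Σ-suc f) (cong (_+_ (f fzero)) (sym (Σ-suc (λ y → if y == fzero then 0 else f y))))
Σ-remove {suc n} f (fsuc c) = begin
  Σf f                                   ≡⟨ Σ-suc f ⟩
  f fzero + Σf (f ∘ fsuc)                ≡⟨ cong (_+_ (f fzero)) (Σ-remove (f ∘ fsuc) c) ⟩
  f fzero + (f (fsuc c) + rest)          ≡⟨ interchange +-commutativeSemigroup 0 (f fzero) (f (fsuc c)) rest ⟩
  f (fsuc c) + (f fzero + rest)          ≡⟨ cong (_+_ (f (fsuc c))) (sym removed-at-fsuc) ⟩
  f (fsuc c) + Σf (λ y → if y == fsuc c then 0 else f y) ∎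
  where
  open ≡-Reasoning
  rest : ℕ
  rest = Σf {n} (λ y → if y == c then 0 else f (fsuc y))
  fsuc-== : ∀ y → (fsuc y == fsuc c) ≡ (y == c)
  fsuc-== y = by-cases (y ≟ c)
    where
    by-cases : Dec (y ≡ c) → (fsuc y == fsuc c) ≡ (y == c)
    by-cases (yes refl) = trans (==-refl (fsuc y)) (sym (==-refl y))
    by-cases (no y≢c) = trans (==-distinct (y≢c ∘ Fin.suc-injective)) (sym (==-distinct y≢c))
  removed-at-fsuc : Σf {suc n} (λ y → if y == fsuc c then 0 else f y) ≡ f fzero + rest
  removed-at-fsuc = trans (Σ-suc (λ y → if y == fsuc c then 0 else f y)) (cong (_+_ (f fzero))
    (Σ-cong λ y → cong (λ b → if b then 0 else f (fsuc y)) (fsuc-== y)))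

Σ-exchange-≤ : ∀ {n} (f g : Fin n → ℕ) (c d : Fin n) → f c ≤ g d → f d ≡ 0 →
  (∀ y → y ≢ c → y ≢ d → f y ≤ g y) → Σf f ≤ Σf g
Σ-exchange-≤ f g c d fc≤gd fd≡0 f≤g rewrite Σ-remove f c | Σ-remove g d = +-mono-≤ fc≤gd (Σ-mono pointwise)
  where
  pointwise : ∀ y → (if y == c then 0 else f y) ≤ (if y == d then 0 else g y)
  pointwise y with y ≟ c | y ≟ d
  ... | yes _ | _ = z≤n
  ... | no y≢c | yes refl rewrite fd≡0 = z≤n
  ... | no y≢c | no y≢d = f≤g y y≢c y≢d

restrict : ∀ {n} → (Fin n → Bool) → (Fin n → ℕ) → Fin n → ℕ
restrict Q g y = if Q y then g y else 0

Σ⟨_⟩_ : ∀ {n} → (Fin n → Bool) → (Fin n → ℕ) → ℕ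
Σ⟨ Q ⟩ g = Σf (restrict Q g)

Σ⟨⟩-subset : ∀ {n} (Q R : Fin n → Bool) (g : Fin n → ℕ) →
  (∀ y → Q y ≡ true → R y ≡ true) → Σ⟨ Q ⟩ g ≤ Σ⟨ R ⟩ g
Σ⟨⟩-subset Q R g Q⊆R = Σ-mono pointwise
  where
  pointwise : ∀ y → (if Q y then g y else 0) ≤ (if R y then g y else 0)
  pointwise y with bool-dec (Q y)
  ... | inj₁ Qy rewrite Qy | Q⊆R y Qy = ≤-refl
  ... | inj₂ ¬Qy rewrite ¬Qy = z≤n

Σ⟨⟩-mono : ∀ {n} (Q : Fin n → Bool) (g h : Fin n → ℕ) →
  (∀ y → Q y ≡ true → g y ≤ h y) → Σ⟨ Q ⟩ g ≤ Σ⟨ Q ⟩ h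
Σ⟨⟩-mono Q g h g≤h = Σ-mono pointwise
  where
  pointwise : ∀ y → (if Q y then g y else 0) ≤ (if Q y then h y else 0)
  pointwise y with bool-dec (Q y)
  ... | inj₁ Qy rewrite Qy = g≤h y Qy
  ... | inj₂ ¬Qy rewrite ¬Qy = z≤n

Σ⟨⟩-point : ∀ {n} (b : Fin n) (g : Fin n → ℕ) → Σ⟨ (_== b) ⟩ g ≡ g b
Σ⟨⟩-point {n} b g = begin
  Σ⟨ (_== b) ⟩ g                               ≡⟨ Σ-remove _ b ⟩
  (if b == b then g b else 0) + Σf elsewhere   ≡⟨ cong₂ _+_ (cong (λ c → if c then g b else 0) (==-refl b))
                                                             (sum-zero (allFin n) elsewhere vanishes) ⟩
  g b + 0                                      ≡⟨ +-identityʳ (g b) ⟩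
  g b ∎
  where
  open ≡-Reasoning
  elsewhere : Fin n → ℕ
  elsewhere y = if y == b then 0 else (if y == b then g y else 0)
  vanishes : ∀ y → elsewhere y ≡ 0
  vanishes y with y == b
  ... | true = refl
  ... | false = refl

Σ⟨⟩-none : ∀ {n} (g : Fin n → ℕ) → Σ⟨ (λ _ → false) ⟩ g ≡ 0
Σ⟨⟩-none {n} g = sum-zero (allFin n) _ (λ _ → refl)

Σ⟨⟩-∨ : ∀ {n} (Q R : Fin n → Bool) (g : Fin n → ℕ) →
  Σ⟨ (λ y → Q y ∨ R y) ⟩ g ≤ Σ⟨ Q ⟩ g + Σ⟨ R ⟩ g
Σ⟨⟩-∨ Q R g = ≤-trans (Σ-mono pointwise) (≤-reflexive (Σ-+ (restrict Q g) (restrict R g)))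
  where
  pointwise : ∀ y → (if Q y ∨ R y then g y else 0) ≤ (if Q y then g y else 0) + (if R y then g y else 0)
  pointwise y with Q y
  ... | true = m≤m+n (g y) _
  ... | false = ≤-refl

Σ⟨⟩-∨-disjoint : ∀ {n} (Q R : Fin n → Bool) (g : Fin n → ℕ) → (∀ y → Q y ≡ true → R y ≡ false) →
  Σ⟨ Q ⟩ g + Σ⟨ R ⟩ g ≤ Σ⟨ (λ y → Q y ∨ R y) ⟩ g
Σ⟨⟩-∨-disjoint Q R g disjoint =
  ≤-trans (≤-reflexive (sym (Σ-+ (restrict Q g) (restrict R g)))) (Σ-mono pointwise)
  where
  pointwise : ∀ y → (if Q y then g y else 0) + (if R y then g y else 0) ≤ (if Q y ∨ R y then g y else 0)
  pointwise y with bool-dec (Q y)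
  ... | inj₁ Qy rewrite Qy | disjoint y Qy = ≤-reflexive (+-identityʳ (g y))
  ... | inj₂ ¬Qy rewrite ¬Qy = ≤-refl

nbr-≤ : ∀ {n} (a : Adj n) (x b : Fin n) (Q : Fin n → Bool) (g : Fin n → ℕ) →
  (∀ y → a x y ≡ true → y ≡ b ⊎ Q y ≡ true) → Σ⟨ a x ⟩ g ≤ g b + Σ⟨ Q ⟩ g
nbr-≤ a x b Q g covered = begin
  Σ⟨ a x ⟩ g                       ≤⟨ Σ⟨⟩-subset (a x) (λ y → y == b ∨ Q y) g inside ⟩
  Σ⟨ (λ y → y == b ∨ Q y) ⟩ g      ≤⟨ Σ⟨⟩-∨ (_== b) Q g ⟩
  Σ⟨ (_== b) ⟩ g + Σ⟨ Q ⟩ g        ≡⟨ cong (_+ Σ⟨ Q ⟩ g) (Σ⟨⟩-point b g) ⟩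
  g b + Σ⟨ Q ⟩ g ∎
  where
  open ≤-Reasoning
  inside : ∀ y → a x y ≡ true → (y == b ∨ Q y) ≡ true
  inside y axy with covered y axy
  ... | inj₁ refl rewrite ==-refl b = refl
  ... | inj₂ Qy rewrite Qy = ∨-zeroʳ (y == b)

nbr-≥ : ∀ {n} (a : Adj n) (x b : Fin n) (Q : Fin n → Bool) (g : Fin n → ℕ) →
  a x b ≡ true → Q b ≡ false → (∀ y → Q y ≡ true → a x y ≡ true) → g b + Σ⟨ Q ⟩ g ≤ Σ⟨ a x ⟩ g
nbr-≥ a x b Q g axb ¬Qb Q⊆nbrs = begin
  g b + Σ⟨ Q ⟩ g                   ≡⟨ cong (_+ Σ⟨ Q ⟩ g) (sym (Σ⟨⟩-point b g)) ⟩
  Σ⟨ (_== b) ⟩ g + Σ⟨ Q ⟩ g        ≤⟨ Σ⟨⟩-∨-disjoint (_== b) Q g disjoint ⟩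
  Σ⟨ (λ y → y == b ∨ Q y) ⟩ g      ≤⟨ Σ⟨⟩-subset (λ y → y == b ∨ Q y) (a x) g inside ⟩
  Σ⟨ a x ⟩ g ∎
  where
  open ≤-Reasoning
  disjoint : ∀ y → (y == b) ≡ true → Q y ≡ false
  disjoint y y==b = subst (λ w → Q w ≡ false) (sym (==-sound y==b)) ¬Qb
  inside : ∀ y → (y == b ∨ Q y) ≡ true → a x y ≡ true
  inside y e with ∨-split {y == b} e
  ... | inj₁ y==b = subst (λ w → a x w ≡ true) (sym (==-sound y==b)) axb
  ... | inj₂ Qy = Q⊆nbrs y Qy

degree-two-nbrs : ∀ {n} (a : Adj n) {x b c y : Fin n} → deg a x ≡ 2 →
  a x b ≡ true → a x c ≡ true → b ≢ c → a x y ≡ true → y ≡ b ⊎ y ≡ c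
degree-two-nbrs {n} a {x} {b} {c} {y} deg≡2 axb axc b≢c axy with y ≟ b | y ≟ c
... | yes y≡b | _ = inj₁ y≡b
... | no _ | yes y≡c = inj₂ y≡c
... | no y≢b | no y≢c = ⊥-elim (3≰2 (subst (3 ≤_) deg≡2 three-nbrs))
  where
  open ≤-Reasoning
  unit : Fin n → ℕ
  unit _ = 1
  3≰2 : ¬ 3 ≤ 2
  3≰2 (s≤s (s≤s ()))
  c-or-y : Fin n → Bool
  c-or-y z = z == c ∨ z == y
  disjoint : ∀ z → (z == c) ≡ true → (z == y) ≡ false
  disjoint z z==c rewrite ==-sound z==c = ==-distinct (y≢c ∘ sym)
  b-outside : c-or-y b ≡ false
  b-outside rewrite ==-distinct b≢c | ==-distinct (y≢b ∘ sym) = refl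
  inside : ∀ z → c-or-y z ≡ true → a x z ≡ true
  inside z e with ∨-split {z == c} e
  ... | inj₁ z==c rewrite ==-sound z==c = axc
  ... | inj₂ z==y rewrite ==-sound z==y = axy
  three-nbrs : 3 ≤ deg a x
  three-nbrs = begin
    1 + (1 + 1)                  ≡⟨ cong (_+_ 1) (sym (cong₂ _+_ (Σ⟨⟩-point c unit) (Σ⟨⟩-point y unit))) ⟩
    1 + (Σ⟨ (_== c) ⟩ unit + Σ⟨ (_== y) ⟩ unit)
                                 ≤⟨ +-monoʳ-≤ 1 (Σ⟨⟩-∨-disjoint (_== c) (_== y) unit disjoint) ⟩
    1 + Σ⟨ c-or-y ⟩ unit         ≤⟨ nbr-≥ a x b c-or-y unit axb b-outside inside ⟩
    deg a x ∎

-- Walk counts.  Definitionally ω (suc t) x a = Σ⟨ a x ⟩ (λ y → ω t y a), so the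
-- neighbourhood bounds above become recursions for walk counts.

module _ {n : ℕ} (a : Adj n) where

  ω-≤ : ∀ t x b (Q : Fin n → Bool) → (∀ y → a x y ≡ true → y ≡ b ⊎ Q y ≡ true) →
    ω (suc t) x a ≤ ω t b a + Σ⟨ Q ⟩ (λ y → ω t y a)
  ω-≤ t x b Q = nbr-≤ a x b Q (λ y → ω t y a)

  ω-≥ : ∀ t x b (Q : Fin n → Bool) → a x b ≡ true → Q b ≡ false → (∀ y → Q y ≡ true → a x y ≡ true) →
    ω t b a + Σ⟨ Q ⟩ (λ y → ω t y a) ≤ ω (suc t) x a
  ω-≥ t x b Q = nbr-≥ a x b Q (λ y → ω t y a)

  ω-≤₁ : ∀ t x b → (∀ y → a x y ≡ true → y ≡ b) → ω (suc t) x a ≤ ω t b a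
  ω-≤₁ t x b only-b = ≤-trans (ω-≤ t x b (λ _ → false) (λ y axy → inj₁ (only-b y axy)))
    (≤-reflexive (trans (cong (_+_ (ω t b a)) (Σ⟨⟩-none (λ y → ω t y a))) (+-identityʳ _)))

  ω-≤₂ : ∀ t x b c → (∀ y → a x y ≡ true → y ≡ b ⊎ y ≡ c) → ω (suc t) x a ≤ ω t b a + ω t c a
  ω-≤₂ t x b c b-or-c = subst (ω (suc t) x a ≤_) (cong (_+_ (ω t b a)) (Σ⟨⟩-point c (λ y → ω t y a)))
    (ω-≤ t x b (_== c) covered)
    where
    covered : ∀ y → a x y ≡ true → y ≡ b ⊎ (y == c) ≡ true
    covered y axy with b-or-c y axy
    ... | inj₁ y≡b = inj₁ y≡b
    ... | inj₂ refl = inj₂ (==-refl c)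

  ω-≥₁ : ∀ t x b → a x b ≡ true → ω t b a ≤ ω (suc t) x a
  ω-≥₁ t x b axb = ≤-trans (m≤m+n _ _) (ω-≥ t x b (λ _ → false) axb refl (λ _ ()))

  ω-≥₂ : ∀ t x b c → a x b ≡ true → a x c ≡ true → b ≢ c → ω t b a + ω t c a ≤ ω (suc t) x a
  ω-≥₂ t x b c axb axc b≢c = subst (_≤ ω (suc t) x a) (cong (_+_ (ω t b a)) (Σ⟨⟩-point c (λ y → ω t y a)))
    (ω-≥ t x b (_== c) axb (==-distinct b≢c) (λ y y==c → subst (λ w → a x w ≡ true) (sym (==-sound y==c)) axc))

  ω-grows : (S : Fin n → Bool) → (∀ x y → a x y ≡ true → S y ≡ true) →
    (∀ x → S x ≡ true → Σ (Fin n) λ y → a x y ≡ true) →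
    ∀ t x → S x ≡ true → ω t x a ≤ ω (suc t) x a
  ω-grows S closed has-nbr zero x Sx = ω-≥₁ 0 x _ (proj₂ (has-nbr x Sx))
  ω-grows S closed has-nbr (suc t) x Sx =
    Σ⟨⟩-mono (a x) _ _ (λ y axy → ω-grows S closed has-nbr t y (closed x y axy))

ω-cong : ∀ {n} (a b : Adj n) → (∀ x y → a x y ≡ b x y) → ∀ t x → ω t x a ≡ ω t x b
ω-cong a b a≡b zero x = refl
ω-cong a b a≡b (suc t) x = Σ-cong λ y → cong₂ (λ e w → if e then w else 0) (a≡b x y) (ω-cong a b a≡b t y)

module Reflection {n : ℕ} (a : Adj n) (q : ℕ → Fin n) (L : ℕ) (L-even : Σ ℕ λ h → L ≡ 2 * h)
  (leaf : ∀ y → a (q 0) y ≡ true → y ≡ q 1)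
  (first-half : ∀ i j → suc i + j ≡ L → suc i < j →
    ∀ y → a (q (suc i)) y ≡ true → y ≡ q i ⊎ y ≡ q (suc (suc i)))
  (forward : ∀ i → i < L → a (q i) (q (suc i)) ≡ true)
  (symmetric : ∀ x y → a x y ≡ a y x)
  (no-return : ∀ i → suc i < L → q i ≢ q (suc (suc i))) where

  -- mirror vertices are never neighbours on the walk, since L is even
  backward : ∀ i → i < L → a (q (suc i)) (q i) ≡ true
  backward i i<L = trans (symmetric _ _) (forward i i<L)

  mirror-gap : ∀ {i j} → i + j ≡ L → suc i ≢ j
  mirror-gap {i} sum refl = even≢odd h i (begin
    2 * h         ≡⟨ sym L≡2h ⟩
    L             ≡⟨ sym sum ⟩
    i + suc i     ≡⟨ +-suc i i ⟩
    suc (i + i)   ≡⟨ cong (λ w → suc (i + w)) (sym (+-identityʳ i)) ⟩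
    suc (2 * i)   ∎)
    where
    open ≡-Reasoning
    h = proj₁ L-even
    L≡2h = proj₂ L-even

  reflection : ∀ t i j → i + j ≡ L → i ≤ j → ω t (q i) a ≤ ω t (q j) a
  reflection zero i j _ _ = ≤-refl
  reflection (suc t) i j sum i≤j with i ≟ℕ j
  ... | yes refl = ≤-refl
  ... | no i≢j = mirror-step i j sum (≤∧≢⇒< i≤j i≢j)
    where
    open ≤-Reasoning
    IH = reflection t
    mirror-step : ∀ i j → i + j ≡ L → i < j → ω (suc t) (q i) a ≤ ω (suc t) (q j) a
    mirror-step zero (suc j') sum _ = begin
      ω (suc t) (q 0) a    ≤⟨ ω-≤₁ a t (q 0) (q 1) leaf ⟩
      ω t (q 1) a          ≤⟨ IH 1 j' sum (positive j' sum) ⟩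
      ω t (q j') a         ≤⟨ ω-≥₁ a t (q (suc j')) (q j') (backward j' (subst (j' <_) sum (n<1+n j'))) ⟩
      ω (suc t) (q (suc j')) a ∎
      where
      positive : ∀ j' → suc j' ≡ L → 1 ≤ j'
      positive zero L≡1 = ⊥-elim (mirror-gap {0} {1} L≡1 refl)
      positive (suc _) _ = s≤s z≤n
    mirror-step (suc i') (suc j') sum i<j = begin
      ω (suc t) (q (suc i')) a                  ≤⟨ ω-≤₂ a t _ _ _ (first-half i' (suc j') sum i<j) ⟩
      ω t (q i') a + ω t (q (suc (suc i'))) a   ≤⟨ +-mono-≤ (IH i' (suc (suc j')) sum₁ le₁)
                                                             (IH (suc (suc i')) j' sum₂ le₂) ⟩
      ω t (q (suc (suc j'))) a + ω t (q j') a   ≤⟨ ω-≥₂ a t _ _ _ (forward (suc j') j<L) (backward j' (<⇒≤ j<L))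
                                                     (no-return j' j<L ∘ sym) ⟩
      ω (suc t) (q (suc j')) a ∎
      where
      sum₁ : i' + suc (suc j') ≡ L
      sum₁ = trans (+-suc i' (suc j')) sum
      le₁ : i' ≤ suc (suc j')
      le₁ = ≤-trans (n≤1+n i') (≤-trans (<⇒≤ i<j) (n≤1+n (suc j')))
      sum₂ : suc (suc i') + j' ≡ L
      sum₂ = trans (cong suc (sym (+-suc i' j'))) sum
      le₂ : suc (suc i') ≤ j'
      le₂ = ≤∧≢⇒< (s≤s⁻¹ i<j) (λ e → mirror-gap sum (cong suc e))
      j<L : suc j' < L
      j<L = subst (suc (suc j') ≤_) sum₁ (m≤n+m _ i')

-- Walks, simple paths and cycles

walk-snoc : ∀ {n} {c : Adj n} {u v w} → Walk c u v → c v w ≡ true → Walk c u w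
walk-snoc (here _) e = step e (here _)
walk-snoc (step e' W) e = step e' (walk-snoc W e)

walk-last-step : ∀ {n} {c : Adj n} {u v} → Walk c u v →
  u ≡ v ⊎ Σ (Fin n) λ y → Walk c u y × c y v ≡ true
walk-last-step (here _) = inj₁ refl
walk-last-step (step {x} e W) with walk-last-step W
... | inj₁ refl = inj₂ (x , here x , e)
... | inj₂ (y , W' , e') = inj₂ (y , step e W' , e')

data Last {A : Set} : List A → A → Set where
  last-one  : ∀ x → Last (x ∷ []) x
  last-cons : ∀ {x y ys v} → Last (y ∷ ys) v → Last (x ∷ y ∷ ys) v

last-split : ∀ {A : Set} {x v : A} {ws} → Last (x ∷ ws) v →
  (ws ≡ [] × x ≡ v) ⊎ Σ (List A) λ qs → ws ≡ qs ++ [ v ]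
last-split (last-one _) = inj₁ (refl , refl)
last-split (last-cons {y = y} l) with last-split l
... | inj₁ (refl , refl) = inj₂ ([] , refl)
... | inj₂ (qs , refl) = inj₂ (y ∷ qs , refl)

record SimplePath {n} (c : Adj n) (u v : Fin n) : Set where
  constructor simple-path
  field
    rest   : List (Fin n)
    unique : Unique (u ∷ rest)
    chain  : Chain c (u ∷ rest)
    last   : Last (u ∷ rest) v

suffix-from : ∀ {n} {c : Adj n} {u v} {xs : List (Fin n)} →
  u ∈ xs → Unique xs → Chain c xs → Last xs v → SimplePath c u v
suffix-from {xs = x ∷ rest} (here refl) uq ch l = simple-path rest uq ch l
suffix-from {xs = x ∷ y ∷ ys} (there u∈) (_ ∷ uq) (cons _ ch) (last-cons l) = suffix-from u∈ uq ch l

-- Every walk contains a simple path between its ends (cut out the closed detours).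
walk⇒simple-path : ∀ {n} {c : Adj n} {u v} → Walk c u v → SimplePath c u v
walk⇒simple-path (here x) = simple-path [] ([] ∷ []) (one x) (last-one x)
walk⇒simple-path (step {u} {y} e W) with walk⇒simple-path W
... | simple-path ws uq ch l with Any-any? (u ≟_) (y ∷ ws)
...   | yes u∈ = suffix-from u∈ uq ch l
...   | no u∉ = simple-path (y ∷ ws) (¬Any⇒All¬ (y ∷ ws) u∉ ∷ uq) (cons e ch) (last-cons l)

chain-++ : ∀ {n} {c : Adj n} {xs x ys} → Chain c xs → Last xs x → Chain c (x ∷ ys) → Chain c (xs ++ ys)
chain-++ (one x) (last-one x) ch = ch
chain-++ (cons e ch₁) (last-cons l) ch = cons e (chain-++ ch₁ l ch)

chain-mono : ∀ {n} {c d : Adj n} {xs} → (∀ x y → c x y ≡ true → d x y ≡ true) → Chain c xs → Chain d xs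
chain-mono c⊆d nil = nil
chain-mono c⊆d (one x) = one x
chain-mono c⊆d (cons e ch) = cons (c⊆d _ _ e) (chain-mono c⊆d ch)

chain-successor : ∀ {n} {c : Adj n} {xs x y} → Chain c (xs ++ [ x ]) → y ∈ xs → Σ (Fin n) λ z → c y z ≡ true
chain-successor {xs = _ ∷ []} (cons e _) (here refl) = _ , e
chain-successor {xs = _ ∷ _ ∷ _} (cons e _) (here refl) = _ , e
chain-successor {xs = _ ∷ _ ∷ _} (cons _ ch) (there y∈) = chain-successor ch y∈

unique-last : ∀ {A : Set} {xs : List A} {x} → Unique (xs ++ [ x ]) → x ∈ xs → ⊥
unique-last {xs = _ ∷ xs} (x∉ ∷ _) (here refl) with ++⁻ʳ xs x∉
... | x≢x ∷ [] = x≢x refl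
unique-last {xs = _ ∷ _} (_ ∷ uq) (there x∈) = unique-last uq x∈

unique-prefix : ∀ {A : Set} (xs : List A) {ys} → Unique (xs ++ ys) → Unique xs
unique-prefix [] _ = []
unique-prefix (x ∷ xs) (x∉ ∷ uq) = ++⁻ˡ xs x∉ ∷ unique-prefix xs uq

path-chain : ∀ {n} (c : Adj n) (p : ℕ → Fin n) k → (∀ i → i < k → c (p i) (p (suc i)) ≡ true) →
  Chain c (applyUpTo p (suc k))
path-chain c p zero _ = one _
path-chain c p (suc zero) adj = cons (adj 0 (s≤s z≤n)) (one _)
path-chain c p (suc (suc k)) adj =
  cons (adj 0 (s≤s z≤n)) (path-chain c (p ∘ suc) (suc k) (λ i i<k → adj (suc i) (s≤s i<k)))

path-last : ∀ {n} (p : ℕ → Fin n) k → Last (applyUpTo p (suc k)) (p k)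
path-last p zero = last-one _
path-last p (suc zero) = last-cons (last-one _)
path-last p (suc (suc k)) = last-cons (path-last (p ∘ suc) (suc k))

cycle-closing : ∀ {n} (c : Adj n) (p : ℕ → Fin n) k (qs : List (Fin n)) →
  (∀ i → i < suc k → c (p i) (p (suc i)) ≡ true) → Chain c (p (suc k) ∷ qs ++ [ p 0 ]) →
  Unique (applyUpTo p (suc (suc k)) ++ qs) → 2 ≤ suc k + length qs → HasCycle c
cycle-closing {n} c p k qs adj return distinct long = p 0 , around , enough , distinct , closed
  where
  around : List (Fin n)
  around = applyUpTo (p ∘ suc) (suc k) ++ qs
  enough : 2 ≤ length around
  enough = subst (2 ≤_) (sym (trans (length-++ (applyUpTo (p ∘ suc) (suc k)))
                                   (cong (_+ length qs) (length-applyUpTo (p ∘ suc) (suc k))))) long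
  closed : Chain c (p 0 ∷ around ++ [ p 0 ])
  closed = subst (λ L → Chain c (p 0 ∷ L)) (sym (++-assoc (applyUpTo (p ∘ suc) (suc k)) qs [ p 0 ]))
    (chain-++ (path-chain c p (suc k) adj) (path-last p (suc k)) return)

induced-intro : ∀ {n} {S : Fin n → Bool} {c : Adj n} {x y} → S x ≡ true → S y ≡ true → c x y ≡ true →
  induced S c x y ≡ true
induced-intro {S = S} {c} {x} {y} Sx Sy cxy rewrite Sx | Sy = cxy

induced-sym : ∀ {n} (S : Fin n → Bool) (c : Adj n) → (∀ x y → c x y ≡ c y x) → ∀ x y → induced S c x y ≡ induced S c y x
induced-sym S c c-sym x y rewrite c-sym x y with S x | S y
... | true | true = refl
... | true | false = refl
... | false | true = refl
... | false | false = refl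

-- The configuration of the corollary, for a path p₀ … pₖ with k = K' + 1 ≥ 1.

module Configuration {n : ℕ} (T : SimpleGraph n) (acyclic : ¬ HasCycle (adj T))
  (K' : ℕ) (p : ℕ → Fin n)
  (path : IsPathIn (adj T) (suc K') p) (deg₂ : InteriorDegTwo (adj T) (suc K') p)
  (B : Fin n → Bool)
  (B⇒walk : ∀ v → B v ≡ true → Walk (minusPathEdges (adj T) (suc K') p) (p (suc K')) v)
  (walk⇒B : ∀ v → Walk (minusPathEdges (adj T) (suc K') p) (p (suc K')) v → B v ≡ true) where

  k : ℕ
  k = suc K'

  k≥1 : 1 ≤ k
  k≥1 = s≤s z≤n

  a : Adj n
  a = adj T

  a-sym : ∀ x y → a x y ≡ a y x
  a-sym = SimpleGraph.sym T

  p-inj : ∀ i j → i ≤ k → j ≤ k → p i ≡ p j → i ≡ j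
  p-inj = proj₁ path

  p-adj : ∀ i → i < k → a (p i) (p (suc i)) ≡ true
  p-adj = proj₂ path

  p-adj' : ∀ i → i < k → a (p (suc i)) (p i) ≡ true
  p-adj' i i<k = trans (a-sym _ _) (p-adj i i<k)

  p-distinct : ∀ {i j} → i < j → j ≤ k → p i ≢ p j
  p-distinct i<j j≤k pi≡pj = <⇒≢ i<j (p-inj _ _ (<⇒≤ (<-≤-trans i<j j≤k)) j≤k pi≡pj)

  E : Adj n
  E = minusPathEdges a k p

  S : Fin n → Bool
  S v = B v ∨ inPath k p v

  G G' : Adj n
  G = induced S a
  G' = induced S (moveAdj a k p)

  N : Fin n → Bool
  N z = a (p k) z ∧ not (z == p K')

  pathAdj-edge : ∀ i → i < k → pathAdj k p (p i) (p (suc i)) ≡ true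
  pathAdj-edge i i<k = any-upTo⁺ _ i<k forward-match
    where
    forward-match : ((p i == p i ∧ p (suc i) == p (suc i)) ∨ (p (suc i) == p i ∧ p i == p (suc i))) ≡ true
    forward-match rewrite ==-refl (p i) | ==-refl (p (suc i)) = refl

  pathAdj-sym : ∀ x y → pathAdj k p x y ≡ pathAdj k p y x
  pathAdj-sym x y = cong or (map-cong (λ i → ∨-comm (x == p i ∧ y == p (suc i)) (y == p i ∧ x == p (suc i))) (upTo k))

  pathAdj-inv : ∀ {x y} → pathAdj k p x y ≡ true →
    Σ ℕ λ i → i < k × ((x ≡ p i × y ≡ p (suc i)) ⊎ (y ≡ p i × x ≡ p (suc i)))
  pathAdj-inv {x} {y} e with any-upTo⁻ _ e
  ... | i , i<k , match with ∨-split {x == p i ∧ y == p (suc i)} match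
  ...   | inj₁ fwd = i , i<k , inj₁ (==-sound (∧-conicalˡ _ _ fwd) , ==-sound (∧-conicalʳ _ _ fwd))
  ...   | inj₂ bwd = i , i<k , inj₂ (==-sound (∧-conicalˡ _ _ bwd) , ==-sound (∧-conicalʳ _ _ bwd))

  pathAdj-at-end : ∀ {y} → pathAdj k p (p k) y ≡ true → y ≡ p K'
  pathAdj-at-end e with pathAdj-inv e
  ... | i , i<k , inj₁ (pk≡pi , _) = ⊥-elim (p-distinct i<k ≤-refl (sym pk≡pi))
  ... | i , i<k , inj₂ (y≡pi , pk≡psi) with p-inj k (suc i) ≤-refl i<k pk≡psi
  ...   | refl = y≡pi

  pathAdj-at-start : ∀ {y} → pathAdj k p y (p 0) ≡ true → y ≡ p 1
  pathAdj-at-start e with pathAdj-inv e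
  ... | i , i<k , inj₁ (_ , p₀≡psi) = ⊥-elim (p-distinct (s≤s z≤n) i<k p₀≡psi)
  ... | i , i<k , inj₂ (p₀≡pi , y≡psi) with p-inj 0 i z≤n (<⇒≤ i<k) p₀≡pi
  ...   | refl = y≡psi

  OffPath : Fin n → Set
  OffPath x = ∀ i → i ≤ k → x ≢ p i

  pathAdj-off : ∀ {x y} → OffPath x → pathAdj k p x y ≡ false
  pathAdj-off {x} {y} off = ¬-not on-path-edge
    where
    on-path-edge : pathAdj k p x y ≢ true
    on-path-edge e with pathAdj-inv e
    ... | i , i<k , inj₁ (x≡pi , _) = off i (<⇒≤ i<k) x≡pi
    ... | i , i<k , inj₂ (_ , x≡psi) = off (suc i) i<k x≡psi

  inPath-inv : ∀ {x} → inPath k p x ≡ true → Σ ℕ λ i → i ≤ k × x ≡ p i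
  inPath-inv e with any-upTo⁻ _ e
  ... | i , s≤s i≤k , x==pi = i , i≤k , ==-sound x==pi

  S-p : ∀ i → i ≤ k → S (p i) ≡ true
  S-p i i≤k rewrite any-upTo⁺ (λ j → p i == p j) (s≤s i≤k) (==-refl (p i)) = ∨-zeroʳ _

  S-B : ∀ {v} → B v ≡ true → S v ≡ true
  S-B Bv rewrite Bv = refl

  S-not-B : ∀ {v} → S v ≡ true → B v ≡ false → inPath k p v ≡ true
  S-not-B Sv ¬Bv rewrite ¬Bv = Sv

  E⇒a : ∀ {x y} → E x y ≡ true → a x y ≡ true
  E⇒a = ∧-conicalˡ _ _

  E-intro : ∀ {x y} → a x y ≡ true → pathAdj k p x y ≡ false → E x y ≡ true
  E-intro = cong₂ (λ e r → e ∧ not r)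

  E-non-edge : ∀ {x y} → a x y ≡ false → E x y ≡ false
  E-non-edge {x} {y} = cong (λ e → e ∧ not (pathAdj k p x y))

  E-path-edge : ∀ {x y} → pathAdj k p x y ≡ true → E x y ≡ false
  E-path-edge {x} {y} e = trans (cong (λ r → a x y ∧ not r) e) (∧-zeroʳ (a x y))

  E-sym : ∀ x y → E x y ≡ E y x
  E-sym x y = cong₂ (λ e r → e ∧ not r) (a-sym x y) (pathAdj-sym x y)

  -- an interior vertex p_{i+1} is adjacent to p_i and p_{i+2} only, so it has no edge in T − E(P)
  interior-nbrs : ∀ i → suc i < k → ∀ {y} → a (p (suc i)) y ≡ true → y ≡ p i ⊎ y ≡ p (suc (suc i))
  interior-nbrs i i<k = degree-two-nbrs a (deg₂ (suc i) (s≤s z≤n) i<k)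
    (p-adj' i (<⇒≤ i<k)) (p-adj (suc i) i<k) (p-distinct (n≤1+n (suc i)) i<k)

  E-interior : ∀ i → suc i < k → ∀ y → E (p (suc i)) y ≡ false
  E-interior i i<k y with bool-dec (a (p (suc i)) y)
  ... | inj₂ no-edge = E-non-edge no-edge
  ... | inj₁ edge with interior-nbrs i i<k edge
  ...   | inj₁ refl = E-path-edge (trans (pathAdj-sym (p (suc i)) (p i)) (pathAdj-edge i (<⇒≤ i<k)))
  ...   | inj₂ refl = E-path-edge (pathAdj-edge (suc i) i<k)

  B-step : ∀ {x y} → B x ≡ true → E x y ≡ true → B y ≡ true
  B-step Bx Exy = walk⇒B _ (walk-snoc (B⇒walk _ Bx) Exy)

  pₖ∈B : B (p k) ≡ true
  pₖ∈B = walk⇒B _ (here _)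

  interior∉B : ∀ i → suc i < k → B (p (suc i)) ≡ true → ⊥
  interior∉B i i<k B-psi with walk-last-step (B⇒walk _ B-psi)
  ... | inj₁ pk≡psi = p-distinct i<k ≤-refl (sym pk≡psi)
  ... | inj₂ (y , _ , Ey) = contradictory (trans (E-sym _ _) Ey) (E-interior i i<k y)

  -- p₀ ∉ B: a simple path from pₖ back to p₀ in T − E(P) avoids the interior of P
  -- (interior vertices have no such edges), so together with P it would close a cycle.
  p₀∉B : B (p 0) ≡ true → ⊥
  p₀∉B p₀∈B with walk⇒simple-path (B⇒walk (p 0) p₀∈B)
  ... | simple-path rest (pₖ∉qs ∷ qs-unique) ch l with last-split l
  ...   | inj₁ (_ , pk≡p₀) = 1+n≢0 (p-inj k 0 ≤-refl z≤n pk≡p₀)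
  ...   | inj₂ (qs , refl) =
          acyclic (cycle-closing a p K' qs p-adj (chain-mono (λ _ _ → E⇒a) ch) distinct (long qs ch))
    where
    off-path : ∀ {v} → v ∈ applyUpTo p (suc k) → v ∈ qs → ⊥
    off-path v∈P v∈qs with ∈-applyUpTo⁻ p v∈P
    ... | i , s≤s i≤k , refl with i ≟ℕ k
    ...   | yes refl = All.lookup pₖ∉qs (∈-++⁺ˡ v∈qs) refl
    ...   | no i≢k with i
    ...     | zero = unique-last qs-unique v∈qs
    ...     | suc i' with chain-successor ch (there v∈qs)
    ...       | y , Ey = contradictory Ey (E-interior i' (≤∧≢⇒< i≤k i≢k) y)
    distinct : Unique (applyUpTo p (suc k) ++ qs)
    distinct = ++⁺ (applyUpTo⁺₁ p (suc k) (λ i<j j<sk → p-distinct i<j (s≤s⁻¹ j<sk)))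
                   (unique-prefix qs qs-unique) (λ (v∈P , v∈qs) → off-path v∈P v∈qs)
    -- a direct return edge pₖ p₀ is not the path edge p₁ p₀, so then k ≥ 2
    long : ∀ qs → Chain E (p k ∷ qs ++ [ p 0 ]) → 2 ≤ k + length qs
    long (_ ∷ qs) _ = subst (2 ≤_) (sym (+-suc k (length qs))) (s≤s (s≤s z≤n))
    long [] (cons Ekp₀ _) = s≤s (≤-trans (n≢0⇒n>0 K'≢0) (m≤m+n K' 0))
      where
      K'≢0 : K' ≢ 0
      K'≢0 K'≡0 = contradictory (subst (λ j → E (p (suc j)) (p 0) ≡ true) K'≡0 Ekp₀)
                                (E-path-edge (trans (pathAdj-sym (p 1) (p 0)) (pathAdj-edge 0 k≥1)))

  B-on-path : ∀ i → i ≤ k → B (p i) ≡ true → i ≡ k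
  B-on-path zero _ p₀∈B = ⊥-elim (p₀∉B p₀∈B)
  B-on-path (suc i) i≤k B-psi with suc i ≟ℕ k
  ... | yes i≡k = i≡k
  ... | no i≢k = ⊥-elim (interior∉B i (≤∧≢⇒< i≤k i≢k) B-psi)

  B-off-path : ∀ {x} → B x ≡ true → x ≢ p k → OffPath x
  B-off-path Bx x≢pk i i≤k refl with B-on-path i i≤k Bx
  ... | refl = x≢pk refl

  B-closed : ∀ {x y} → B x ≡ true → x ≢ p k → a x y ≡ true → B y ≡ true
  B-closed Bx x≢pk axy = B-step Bx (E-intro axy (pathAdj-off (B-off-path Bx x≢pk)))

  no-E-edge-to-p₀ : ∀ y → S y ≡ true → E y (p 0) ≡ true → ⊥
  no-E-edge-to-p₀ y Sy Ey with bool-dec (B y)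
  ... | inj₁ By = p₀∉B (B-step By Ey)
  ... | inj₂ ¬By with inPath-inv {y} (S-not-B {y} Sy ¬By)
  ...   | zero , _ , refl = contradictory (E⇒a Ey) (irrefl T (p 0))
  ...   | suc i , i≤k , refl with suc i ≟ℕ k
  ...     | yes refl = contradictory pₖ∈B ¬By
  ...     | no i≢k = contradictory Ey (E-interior i (≤∧≢⇒< i≤k i≢k) (p 0))

  N⇒a : ∀ {z} → N z ≡ true → a (p k) z ≡ true
  N⇒a = ∧-conicalˡ _ _

  N-not-pₖ₋₁ : ∀ {z} → N z ≡ true → z ≢ p K'
  N-not-pₖ₋₁ Nz refl = contradictory (∧-conicalʳ _ _ Nz) (cong not (==-refl (p K')))

  N-not-pₖ : ∀ {z} → N z ≡ true → z ≢ p k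
  N-not-pₖ Nz refl = contradictory (N⇒a Nz) (irrefl T (p k))

  N⊆B : ∀ {z} → N z ≡ true → B z ≡ true
  N⊆B Nz = B-step pₖ∈B (E-intro (N⇒a Nz) (¬-not (N-not-pₖ₋₁ Nz ∘ pathAdj-at-end)))

  pₖ₋₁∉N : N (p K') ≡ false
  pₖ₋₁∉N = ¬-not (λ Nz → N-not-pₖ₋₁ Nz refl)

  p₁∉N : N (p 1) ≡ false
  p₁∉N = ¬-not (λ N₁ → N-not-pₖ N₁ (cong p (B-on-path 1 k≥1 (N⊆B N₁))))

  B-nbr-of-pₖ : ∀ {v} → B v ≡ true → a (p k) v ≡ true → N v ≡ true
  B-nbr-of-pₖ Bv akv = ∧-intro akv (cong not (==-distinct v≢pₖ₋₁))
    where
    v≢pₖ₋₁ : _ ≢ p K'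
    v≢pₖ₋₁ refl = 1+n≢n (sym (B-on-path K' (n≤1+n K') Bv))

  G-intro : ∀ {x y} → S x ≡ true → S y ≡ true → a x y ≡ true → G x y ≡ true
  G-intro = induced-intro {S = S} {c = a}

  G⇒a : ∀ {x y} → G x y ≡ true → a x y ≡ true
  G⇒a {x} {y} e = ∧-conicalʳ (S y) (a x y) (∧-conicalʳ (S x) (S y ∧ a x y) e)

  G⇒S : ∀ x y → G x y ≡ true → S y ≡ true
  G⇒S x y e = ∧-conicalˡ (S y) (a x y) (∧-conicalʳ (S x) (S y ∧ a x y) e)

  G-sym : ∀ x y → G x y ≡ G y x
  G-sym = induced-sym S a a-sym

  G-path : ∀ i → i < k → G (p i) (p (suc i)) ≡ true
  G-path i i<k = G-intro (S-p i (<⇒≤ i<k)) (S-p (suc i) i<k) (p-adj i i<k)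

  G-path' : ∀ i → i < k → G (p (suc i)) (p i) ≡ true
  G-path' i i<k = trans (G-sym _ _) (G-path i i<k)

  G-leaf : ∀ y → G (p 0) y ≡ true → y ≡ p 1
  G-leaf y G₀y with bool-dec (pathAdj k p y (p 0))
  ... | inj₁ path-edge = pathAdj-at-start path-edge
  ... | inj₂ not-path-edge =
        ⊥-elim (no-E-edge-to-p₀ y (G⇒S _ _ G₀y) (E-intro (trans (a-sym y (p 0)) (G⇒a G₀y)) not-path-edge))

  G-interior : ∀ i → suc i < k → ∀ y → G (p (suc i)) y ≡ true → y ≡ p i ⊎ y ≡ p (suc (suc i))
  G-interior i i<k y = interior-nbrs i i<k ∘ G⇒a

  G-end : ∀ y → G (p k) y ≡ true → y ≡ p K' ⊎ N y ≡ true
  G-end y G-ky with bool-dec (y == p K')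
  ... | inj₁ y==pₖ₋₁ = inj₁ (==-sound y==pₖ₋₁)
  ... | inj₂ y≠pₖ₋₁ = inj₂ (∧-intro (G⇒a G-ky) (cong not y≠pₖ₋₁))

  G-nbr : ∀ x → S x ≡ true → Σ (Fin n) λ y → G x y ≡ true
  G-nbr x Sx with ∨-split {B x} Sx
  ... | inj₂ x∈P with inPath-inv {x} x∈P
  ...   | zero , _ , refl = p 1 , G-path 0 k≥1
  ...   | suc i , i<k , refl = p i , G-path' i i<k
  G-nbr x Sx | inj₁ Bx with walk-last-step (B⇒walk x Bx)
  ... | inj₁ refl = p K' , G-path' K' ≤-refl
  ... | inj₂ (y , W , Eyx) = y , G-intro Sx (S-B (walk⇒B y W)) (trans (a-sym x y) (E⇒a Eyx))

  G-branch : ∀ {v y} → B v ≡ true → v ≢ p k → G v y ≡ true → B y ≡ true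
  G-branch Bv v≢pk G-vy = B-closed Bv v≢pk (G⇒a G-vy)

  G-branch-p₀ : ∀ {v} → B v ≡ true → v ≢ p k → G v (p 0) ≡ false
  G-branch-p₀ Bv v≢pk = ¬-not (λ G-v0 → p₀∉B (G-branch Bv v≢pk G-v0))

  G'-intro : ∀ {x y} → S x ≡ true → S y ≡ true → moveAdj a k p x y ≡ true → G' x y ≡ true
  G'-intro = induced-intro {S = S} {c = moveAdj a k p}

  move-kept : ∀ {x y} → a x y ≡ true → (x == p k ∧ N y) ≡ false → (y == p k ∧ N x) ≡ false →
    moveAdj a k p x y ≡ true
  move-kept {x} {y} = moved-kept (x == p 0 ∧ N y) (y == p 0 ∧ N x)

  move-away-from-pₖ : ∀ {x y} → x ≢ p k → y ≢ p k → a x y ≡ true → moveAdj a k p x y ≡ true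
  move-away-from-pₖ {x} {y} x≢pk y≢pk axy =
    move-kept axy (cong (_∧ N y) (==-distinct x≢pk)) (cong (_∧ N x) (==-distinct y≢pk))

  path-edge-not-moved₁ : ∀ i → i < k → ∀ b → (p i == p k ∧ b) ≡ false
  path-edge-not-moved₁ i i<k b = cong (_∧ b) (==-distinct (p-distinct i<k ≤-refl))

  path-edge-not-moved₂ : ∀ i → i < k → (p (suc i) == p k ∧ N (p i)) ≡ false
  path-edge-not-moved₂ i i<k with suc i ≟ℕ k
  ... | yes refl = trans (cong (_∧_ (p k == p k)) pₖ₋₁∉N) (∧-zeroʳ _)
  ... | no i≢k = cong (_∧ N (p i)) (==-distinct (p-distinct (≤∧≢⇒< i<k i≢k) ≤-refl))

  G'-path : ∀ i → i < k → G' (p i) (p (suc i)) ≡ true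
  G'-path i i<k = G'-intro (S-p i (<⇒≤ i<k)) (S-p (suc i) i<k)
    (move-kept (p-adj i i<k) (path-edge-not-moved₁ i i<k _) (path-edge-not-moved₂ i i<k))

  G'-path' : ∀ i → i < k → G' (p (suc i)) (p i) ≡ true
  G'-path' i i<k = G'-intro (S-p (suc i) i<k) (S-p i (<⇒≤ i<k))
    (move-kept (p-adj' i i<k) (path-edge-not-moved₂ i i<k) (path-edge-not-moved₁ i i<k _))

  G'-p₀-N : ∀ y → N y ≡ true → G' (p 0) y ≡ true
  G'-p₀-N y Ny = G'-intro (S-p 0 z≤n) (S-B (N⊆B Ny))
    (moved-added₁ (a (p 0) y) (p 0 == p k ∧ N y) (y == p k ∧ N (p 0)) (y == p 0 ∧ N (p 0))
                  (∧-intro (==-refl (p 0)) Ny))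

  G'-N-p₀ : ∀ {x} → N x ≡ true → G' x (p 0) ≡ true
  G'-N-p₀ {x} Nx = G'-intro (S-B (N⊆B Nx)) (S-p 0 z≤n)
    (moved-added₂ (a x (p 0)) (x == p k ∧ N (p 0)) (p 0 == p k ∧ N x) (x == p 0 ∧ N (p 0))
                  (∧-intro (==-refl (p 0)) Nx))

  G'-branch : ∀ {v y} → B v ≡ true → v ≢ p k → y ≢ p k → G v y ≡ true → G' v y ≡ true
  G'-branch Bv v≢pk y≢pk G-vy = G'-intro (S-B Bv) (G⇒S _ _ G-vy) (move-away-from-pₖ v≢pk y≢pk (G⇒a G-vy))

  G'-trivial : (∀ z → N z ≡ false) → ∀ x y → G x y ≡ G' x y
  G'-trivial N≡∅ x y = cong (λ e → S x ∧ S y ∧ e) (sym (moved-unchanged (a x y)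
    (trans (cong (_∧_ (x == p k)) (N≡∅ y)) (∧-zeroʳ _)) (trans (cong (_∧_ (y == p k)) (N≡∅ x)) (∧-zeroʳ _))
    (trans (cong (_∧_ (x == p 0)) (N≡∅ y)) (∧-zeroʳ _)) (trans (cong (_∧_ (y == p 0)) (N≡∅ x)) (∧-zeroʳ _))))

  -- Reflection along the walk p₀ p₁ … pₖ z in G, for z ∈ N and k odd.

  module ReflectedPath (z : Fin n) (z∈N : N z ≡ true) (m : ℕ) (K'≡2m : K' ≡ 2 * m) where

    q : ℕ → Fin n
    q j with j ≤? k
    ... | yes _ = p j
    ... | no _ = z

    q-on-path : ∀ j → j ≤ k → q j ≡ p j
    q-on-path j j≤k with j ≤? k
    ... | yes _ = refl
    ... | no j≰k = ⊥-elim (j≰k j≤k)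

    q-end : q (suc k) ≡ z
    q-end with suc k ≤? k
    ... | yes k<k = ⊥-elim (<-irrefl refl k<k)
    ... | no _ = refl

    length-even : Σ ℕ λ h → suc k ≡ 2 * h
    length-even = suc m , trans (cong (λ w → suc (suc w)) K'≡2m) (sym (*-suc 2 m))

    leaf : ∀ y → G (q 0) y ≡ true → y ≡ q 1
    leaf y rewrite q-on-path 0 z≤n | q-on-path 1 k≥1 = G-leaf y

    interior : ∀ i → suc i < k → ∀ y → G (q (suc i)) y ≡ true → y ≡ q i ⊎ y ≡ q (suc (suc i))
    interior i i<k y
      rewrite q-on-path (suc i) (<⇒≤ i<k) | q-on-path i (<⇒≤ (<⇒≤ i<k)) | q-on-path (suc (suc i)) i<k
      = G-interior i i<k y

    first-half : ∀ i j → suc i + j ≡ suc k → suc i < j →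
      ∀ y → G (q (suc i)) y ≡ true → y ≡ q i ⊎ y ≡ q (suc (suc i))
    first-half i j sum i<j = interior i (<-≤-trans i<j (subst (j ≤_) (suc-injective sum) (m≤n+m j i)))

    forward : ∀ i → i < suc k → G (q i) (q (suc i)) ≡ true
    forward i (s≤s i≤k) with i ≟ℕ k
    ... | yes refl rewrite q-on-path k ≤-refl | q-end = G-intro (S-p k ≤-refl) (S-B (N⊆B z∈N)) (N⇒a z∈N)
    ... | no i≢k rewrite q-on-path i i≤k | q-on-path (suc i) (≤∧≢⇒< i≤k i≢k) = G-path i (≤∧≢⇒< i≤k i≢k)

    no-return : ∀ i → suc i < suc k → q i ≢ q (suc (suc i))
    no-return i (s≤s i<k) with suc i ≟ℕ k
    ... | yes refl rewrite q-on-path K' (n≤1+n K') | q-end = N-not-pₖ₋₁ z∈N ∘ sym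
    ... | no i≢k rewrite q-on-path i (<⇒≤ i<k) | q-on-path (suc (suc i)) (≤∧≢⇒< i<k i≢k) =
          p-distinct (n≤1+n (suc i)) (≤∧≢⇒< i<k i≢k)

    open Reflection G q (suc k) length-even leaf first-half forward G-sym no-return

    p₀-below-pₖ : ∀ t → ω (suc t) (p 0) G ≤ ω (suc t) (p k) G
    p₀-below-pₖ t = begin
      ω (suc t) (p 0) G   ≤⟨ ω-≤₁ G t (p 0) (p 1) G-leaf ⟩
      ω t (p 1) G         ≡⟨ cong (λ v → ω t v G) (sym (q-on-path 1 k≥1)) ⟩
      ω t (q 1) G         ≤⟨ reflection t 1 k refl k≥1 ⟩
      ω t (q k) G         ≡⟨ cong (λ v → ω t v G) (q-on-path k ≤-refl) ⟩
      ω t (p k) G         ≤⟨ ω-grows G S G⇒S G-nbr t (p k) (S-p k ≤-refl) ⟩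
      ω (suc t) (p k) G   ∎
      where open ≤-Reasoning

  Dominated : ℕ → Set
  Dominated t = (∀ i j → i + j ≡ k → ω t (p i) G ≤ ω t (p j) G')
              × (∀ v → B v ≡ true → v ≢ p k → ω t v G ≤ ω t v G')

  summand-< : ∀ i j → suc i + suc j ≡ k → suc i < k
  summand-< i j sum = subst (suc (suc i) ≤_) sum (s≤s (m<m+n i (s≤s z≤n)))

  -- p₀ is a leaf of G, while pₖ is still joined to pₖ₋₁ in G'
  dominated-start : ∀ {t} → Dominated t → ω (suc t) (p 0) G ≤ ω (suc t) (p k) G'
  dominated-start {t} (path-IH , _) = begin
    ω (suc t) (p 0) G   ≤⟨ ω-≤₁ G t (p 0) (p 1) G-leaf ⟩
    ω t (p 1) G         ≤⟨ path-IH 1 K' refl ⟩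
    ω t (p K') G'       ≤⟨ ω-≥₁ G' t (p k) (p K') (G'-path' K' ≤-refl) ⟩
    ω (suc t) (p k) G'  ∎
    where open ≤-Reasoning

  -- in G the neighbours of pₖ are pₖ₋₁ and N; in G' those of p₀ are p₁ and N
  dominated-end : ∀ {t} → Dominated t → ω (suc t) (p k) G ≤ ω (suc t) (p 0) G'
  dominated-end {t} (path-IH , branch-IH) = begin
    ω (suc t) (p k) G                         ≤⟨ ω-≤ G t (p k) (p K') N G-end ⟩
    ω t (p K') G + Σ⟨ N ⟩ (λ y → ω t y G)      ≤⟨ +-mono-≤ (path-IH K' 1 (+-comm K' 1)) (Σ⟨⟩-mono N _ _ N-IH) ⟩
    ω t (p 1) G' + Σ⟨ N ⟩ (λ y → ω t y G')     ≤⟨ ω-≥ G' t (p 0) (p 1) N (G'-path 0 k≥1) p₁∉N G'-p₀-N ⟩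
    ω (suc t) (p 0) G'                        ∎
    where
    open ≤-Reasoning
    N-IH : ∀ y → N y ≡ true → ω t y G ≤ ω t y G'
    N-IH y Ny = branch-IH y (N⊆B Ny) (N-not-pₖ Ny)

  -- interior path vertices have the same two neighbours in G and G'
  dominated-interior : ∀ {t} → Dominated t → ∀ i j → suc i + suc j ≡ k →
    ω (suc t) (p (suc i)) G ≤ ω (suc t) (p (suc j)) G'
  dominated-interior {t} (path-IH , _) i j sum = begin
    ω (suc t) (p (suc i)) G                  ≤⟨ ω-≤₂ G t _ _ _ (G-interior i (summand-< i j sum)) ⟩
    ω t (p i) G + ω t (p (suc (suc i))) G    ≤⟨ +-mono-≤ (path-IH i (suc (suc j)) sum₁) (path-IH (suc (suc i)) j sum₂) ⟩
    ω t (p (suc (suc j))) G' + ω t (p j) G'  ≤⟨ ω-≥₂ G' t _ _ _ (G'-path (suc j) j<k) (G'-path' j (<⇒≤ j<k))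
                                                  (p-distinct (n≤1+n (suc j)) j<k ∘ sym) ⟩
    ω (suc t) (p (suc j)) G'                 ∎
    where
    open ≤-Reasoning
    sum₁ : i + suc (suc j) ≡ k
    sum₁ = trans (+-suc i (suc j)) sum
    sum₂ : suc (suc i) + j ≡ k
    sum₂ = trans (cong suc (sym (+-suc i j))) sum
    j<k : suc j < k
    j<k = summand-< j i (trans (+-comm (suc j) (suc i)) sum)

  -- a vertex v of B ∖ {pₖ} keeps its neighbours, except that pₖ (if adjacent) is replaced by p₀
  dominated-branch : ∀ {t} → Dominated t → ∀ v → B v ≡ true → v ≢ p k → ω (suc t) v G ≤ ω (suc t) v G'
  dominated-branch {t} (path-IH , branch-IH) v Bv v≢pk =
    Σ-exchange-≤ (restrict (G v) (λ y → ω t y G)) (restrict (G' v) (λ y → ω t y G'))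
      (p k) (p 0) moved-edge no-edge-to-p₀ kept-edges
    where
    moved-edge : (if G v (p k) then ω t (p k) G else 0) ≤ (if G' v (p 0) then ω t (p 0) G' else 0)
    moved-edge with bool-dec (G v (p k))
    ... | inj₂ no-edge rewrite no-edge = z≤n
    ... | inj₁ edge rewrite edge | G'-N-p₀ (B-nbr-of-pₖ Bv (trans (a-sym (p k) v) (G⇒a edge))) =
          path-IH k 0 (+-identityʳ k)
    no-edge-to-p₀ : (if G v (p 0) then ω t (p 0) G else 0) ≡ 0
    no-edge-to-p₀ rewrite G-branch-p₀ Bv v≢pk = refl
    kept-edges : ∀ y → y ≢ p k → y ≢ p 0 → (if G v y then ω t y G else 0) ≤ (if G' v y then ω t y G' else 0)
    kept-edges y y≢pk _ with bool-dec (G v y)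
    ... | inj₂ no-edge rewrite no-edge = z≤n
    ... | inj₁ edge rewrite edge | G'-branch Bv v≢pk y≢pk edge = branch-IH y (G-branch Bv v≢pk edge) y≢pk

  dominated : ∀ t → Dominated t
  dominated zero = (λ _ _ _ → ≤-refl) , (λ _ _ _ → ≤-refl)
  dominated (suc t) = path-step , dominated-branch {t} IH
    where
    IH : Dominated t
    IH = dominated t
    path-step : ∀ i j → i + j ≡ k → ω (suc t) (p i) G ≤ ω (suc t) (p j) G'
    path-step zero j refl = dominated-start {t} IH
    path-step (suc i) zero sum =
      subst (λ w → ω (suc t) (p w) G ≤ ω (suc t) (p 0) G') (sym (trans (sym (+-identityʳ (suc i))) sum)) (dominated-end {t} IH)
    path-step (suc i) (suc j) sum = dominated-interior {t} IH i j sum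

  walks-from-p₀-increase : ∀ m → K' ≡ 2 * m → ∀ t → ω (suc t) (p 0) G ≤ ω (suc t) (p 0) G'
  walks-from-p₀-increase m K'≡2m t with Fin.any? (λ z → N z ≟ᵇ true)
  ... | yes (z , z∈N) = ≤-trans (ReflectedPath.p₀-below-pₖ z z∈N m K'≡2m t) (dominated-end {t} (dominated t))
  ... | no N≡∅ = ≤-reflexive (ω-cong G G' (G'-trivial (λ z → ¬-not (λ Nz → N≡∅ (z , Nz)))) (suc t) (p 0))

-- Corollary 4.  With k = 2m + 1 and ℓ = t + 1 the common term ω_ℓ(p₀,P) is subtracted
-- from both sides of the main inequality.

corollary4 : ∀ {n} (T : SimpleGraph n) → IsTree T →
    (k : ℕ) (p : ℕ → Fin n) → IsPathIn (adj T) k p → InteriorDegTwo (adj T) k p →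
    (B : Fin n → Bool) →
    (∀ v → B v ≡ true → Walk (minusPathEdges (adj T) k p) (p k) v) →
    (∀ v → Walk (minusPathEdges (adj T) k p) (p k) v → B v ≡ true) →
    Odd k → (ℓ : ℕ) → 1 ≤ ℓ →
    (+ ω ℓ (p 0) (induced (λ v → B v ∨ inPath k p v) (adj T))) - (+ ω ℓ (p 0) (pathAdj k p))
      ≤ℤ (+ ω ℓ (p 0) (induced (λ v → B v ∨ inPath k p v) (moveAdj (adj T) k p))) - (+ ω ℓ (p 0) (pathAdj k p))
corollary4 T (_ , acyclic) k p path deg₂ B B⇒walk walk⇒B (m , refl) (suc t) _ =
  ℤ.+-monoˡ-≤ (ℤ.- (+ ω (suc t) (p 0) (pathAdj (suc (2 * m)) p)))
    (ℤ.+≤+ (Configuration.walks-from-p₀-increase T acyclic (2 * m) p path deg₂ B B⇒walk walk⇒B m refl t))
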